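{- Let $r$ and $m$ be positive integers. If there is a strong Schur partition of the integer interval $[1, m] = \{1, 2, \dots, m\}$ into $r$ subsets, then there is a weak Schur partition of $[1, 4m+2]$ into $r+1$ subsets, and there is a weak Schur partition of $[1, 13m+8]$ into $r+2$ subsets.
   Context: A partition of $[1, n]$ into $r$ disjoint non-empty subsets $S_1, \dots, S_r$ is a strong Schur partition if no subset $S_i$ contains integers $a, b, c$ (not necessarily distinct) with $a + b = c$, i.e. each subset is sum-free. It is a weak Schur partition if no subset $S_i$ contains three distinct integers $a, b, c$ with $a + b = c$ (each subset is weakly sum-free). -}

module Defs where

open import Data.Nat using (ℕ; _+_; _≤_)
open import Data.Fin using (Fin)
open import Data.Product using (Σ; _×_)
open import Relation.Binary.PropositionalEquality using (_≡_; _≢_)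
open import Relation.Nullary using (¬_)

-- A partition of [1,n] = {1,...,n} into r subsets S_1..S_r is encoded as a
-- colouring  f : ℕ → Fin r, where S_i = { x ∈ [1,n] | f x ≡ i }.
-- Values of f outside [1,n] are irrelevant.  Disjointness and covering are
-- automatic; non-emptiness of every subset is required explicitly.

AllBlocksNonEmpty : (n r : ℕ) → (ℕ → Fin r) → Set
AllBlocksNonEmpty n r f = (i : Fin r) → Σ ℕ (λ x → (1 ≤ x) × (x ≤ n) × (f x ≡ i))

IsStrongSchurPartition : (n r : ℕ) → (ℕ → Fin r) → Set
IsStrongSchurPartition n r f =
  AllBlocksNonEmpty n r f ×
  ((a b : ℕ) → 1 ≤ a → 1 ≤ b → a + b ≤ n →
     f a ≡ f b → ¬ (f (a + b) ≡ f a))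

-- weak: no block contains three distinct a, b, c with a + b = c
-- (for positive a, b, distinctness of c from a and b is automatic, so only a ≢ b remains)
IsWeakSchurPartition : (n r : ℕ) → (ℕ → Fin r) → Set
IsWeakSchurPartition n r f =
  AllBlocksNonEmpty n r f ×
  ((a b : ℕ) → 1 ≤ a → 1 ≤ b → a ≢ b → a + b ≤ n →
     f a ≡ f b → ¬ (f (a + b) ≡ f a))

HasStrongSchurPartition : (n r : ℕ) → Set
HasStrongSchurPartition n r = Σ (ℕ → Fin r) (IsStrongSchurPartition n r)

HasWeakSchurPartition : (n r : ℕ) → Set
HasWeakSchurPartition n r = Σ (ℕ → Fin r) (IsWeakSchurPartition n r)

{-# OPTIONS --safe #-}
-- Put k = 3s + 1 and start from a strong Schur colouring f of [1, m] and a
-- weak Schur colouring w of [1, 2s].  A number within distance s of a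
-- positive multiple qk gets the colour f q; every other number has residue
-- u mod k in [1, 2s] and gets the colour w u.  Since 3s < k, the quotients of
-- near-multiples add exactly, so a monochromatic a + b = c among them yields
-- one among the quotients in [1, m]; and the residues of the second kind add
-- without carry, so a monochromatic sum of that kind yields one in [1, 2s],
-- unless the two residues coincide, which forces a = b.  The cases s = 1 and
-- s = 4 give the two claims.
module Submission where

open import Data.Fin using (Fin; join; splitAt) renaming (zero to fzero; suc to fsuc)
open import Data.Fin.Properties using (splitAt-join; join-splitAt) renaming (_≟_ to _≟ᶠ_)
open import Data.Nat using (ℕ; zero; suc; _+_; _*_; _≤_; _<_; z≤n; s≤s; _≤?_; _<?_; _≟_; _/_; _%_; NonZero)
open import Data.Nat.DivMod using (m≡m%n+[m/n]*n; m%n<n; [m+kn]%n≡m%n; m<n⇒m%n≡m; m<n⇒m/n≡0; m*n/n≡m; m*n%n≡0)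
open import Data.Nat.Properties
open import Data.Nat.Tactic.RingSolver using (solve-∀)
open import Data.Product using (Σ; _×_; _,_)
open import Data.Sum using (_⊎_; inj₁; inj₂)
open import Function using (_∘_)
open import Relation.Binary.PropositionalEquality
open import Relation.Nullary using (¬_; Dec; yes; no; contradiction)
open import Relation.Nullary.Decidable using (map′; _→-dec_; ¬?; toWitness)
open import Defs

module _ {C : Set} where

  Hits : ℕ → (ℕ → C) → C → Set
  Hits n g c = Σ ℕ λ x → (1 ≤ x) × (x ≤ n) × (g x ≡ c)

  StronglySumFree : ℕ → (ℕ → C) → Set
  StronglySumFree n g =
    (a b : ℕ) → 1 ≤ a → 1 ≤ b → a + b ≤ n → g a ≡ g b → ¬ (g (a + b) ≡ g a)

  WeaklySumFree : ℕ → (ℕ → C) → Set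
  WeaklySumFree n g =
    (a b : ℕ) → 1 ≤ a → 1 ≤ b → a ≢ b → a + b ≤ n → g a ≡ g b → ¬ (g (a + b) ≡ g a)

weaklySumFree? : ∀ {t} n (g : ℕ → Fin t) → Dec (WeaklySumFree n g)
weaklySumFree? n g =
  map′ unbounded bounded (allUpTo? (λ a → allUpTo? (sumFreeAt? a) (suc n)) (suc n))
  where
  SumFreeAt : ℕ → ℕ → Set
  SumFreeAt a b = 1 ≤ a → 1 ≤ b → a ≢ b → a + b ≤ n → g a ≡ g b → ¬ (g (a + b) ≡ g a)

  sumFreeAt? : ∀ a b → Dec (SumFreeAt a b)
  sumFreeAt? a b = (1 ≤? a) →-dec (1 ≤? b) →-dec ¬? (a ≟ b) →-dec (a + b ≤? n) →-dec
                   (g a ≟ᶠ g b) →-dec ¬? (g (a + b) ≟ᶠ g a)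

  unbounded : (∀ {a} → a < suc n → ∀ {b} → b < suc n → SumFreeAt a b) → WeaklySumFree n g
  unbounded h a b 1≤a 1≤b a≢b a+b≤n =
    h (s≤s (m+n≤o⇒m≤o a a+b≤n)) (s≤s (m+n≤o⇒n≤o a a+b≤n)) 1≤a 1≤b a≢b a+b≤n

  bounded : WeaklySumFree n g → ∀ {a} → a < suc n → ∀ {b} → b < suc n → SumFreeAt a b
  bounded h {a} _ {b} _ = h a b

join-injective : ∀ m n {c c′ : Fin m ⊎ Fin n} → join m n c ≡ join m n c′ → c ≡ c′
join-injective m n {c} {c′} eq =
  trans (sym (splitAt-join m n c)) (trans (cong (splitAt m) eq) (splitAt-join m n c′))

isWeakSchurPartition-join : ∀ {n r t} {g : ℕ → Fin r ⊎ Fin t} →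
  (∀ c → Hits n g c) → WeaklySumFree n g → IsWeakSchurPartition n (r + t) (join r t ∘ g)
isWeakSchurPartition-join {r = r} {t} hits sumFree = blocks , sumFree′
  where
  blocks : ∀ i → Hits _ _ i
  blocks i with x , 1≤x , x≤n , gx≡ ← hits (splitAt r i) =
    x , 1≤x , x≤n , trans (cong (join r t) gx≡) (join-splitAt r t i)

  sumFree′ : WeaklySumFree _ _
  sumFree′ a b 1≤a 1≤b a≢b a+b≤n eq eq′ =
    sumFree a b 1≤a 1≤b a≢b a+b≤n (join-injective r t eq) (join-injective r t eq′)

Near : ℕ → ℕ → ℕ → Set
Near d x y = (x ≤ y + d) × (y ≤ x + d)

Near-sym : ∀ {d x y} → Near d x y → Near d y x
Near-sym (x≤ , y≤) = y≤ , x≤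

Near-trans : ∀ {d e x y z} → Near d x y → Near e y z → Near (d + e) x z
Near-trans {d} {e} {x} {z = z} (x≤ , y≤) (y≤′ , z≤) =
  ≤-trans x≤ (≤-trans (+-monoˡ-≤ d y≤′) (≤-reflexive (lemma z e d))) ,
  ≤-trans z≤ (≤-trans (+-monoˡ-≤ e y≤) (≤-reflexive (+-assoc x d e)))
  where
  lemma : ∀ z e d → z + e + d ≡ z + (d + e)
  lemma = solve-∀

Near-+ : ∀ {d e x y x′ y′} → Near d x y → Near e x′ y′ → Near (d + e) (x + x′) (y + y′)
Near-+ {d} {e} {x} {y} {x′} {y′} (x≤ , y≤) (x′≤ , y′≤) =
  ≤-trans (+-mono-≤ x≤ x′≤) (≤-reflexive (lemma y d y′ e)) ,
  ≤-trans (+-mono-≤ y≤ y′≤) (≤-reflexive (lemma x d x′ e))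
  where
  lemma : ∀ y d y′ e → y + d + (y′ + e) ≡ y + y′ + (d + e)
  lemma = solve-∀

Near-+ʳ : ∀ {d x y} z → Near d x y → Near d (x + z) (y + z)
Near-+ʳ {d} {x} {y} z (x≤ , y≤) =
  ≤-trans (+-monoˡ-≤ z x≤) (≤-reflexive (lemma y d z)) ,
  ≤-trans (+-monoˡ-≤ z y≤) (≤-reflexive (lemma x d z))
  where
  lemma : ∀ y d z → y + d + z ≡ y + z + d
  lemma = solve-∀

Near-+ˡ : ∀ {d u} y → u ≤ d → Near d (u + y) y
Near-+ˡ {d} {u} y u≤d =
  ≤-trans (≤-reflexive (+-comm u y)) (+-monoʳ-≤ y u≤d) ,
  ≤-trans (m≤n+m y u) (m≤m+n (u + y) d)

*-cancelʳ-≤-slack : ∀ {k d} x y → d < k → x * k ≤ y * k + d → x ≤ y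
*-cancelʳ-≤-slack {k} {d} x y d<k le = ≤-pred (*-cancelʳ-< k x (suc y) (begin-strict
  x * k      ≤⟨ le ⟩
  y * k + d  <⟨ +-monoʳ-< (y * k) d<k ⟩
  y * k + k  ≡⟨ +-comm (y * k) k ⟩
  suc y * k  ∎))
  where open ≤-Reasoning

*-cancelʳ-Near : ∀ {k d} x y → d < k → Near d (x * k) (y * k) → x ≡ y
*-cancelʳ-Near x y d<k (x≤ , y≤) =
  ≤-antisym (*-cancelʳ-≤-slack x y d<k x≤) (*-cancelʳ-≤-slack y x d<k y≤)

remainder-unique : ∀ {k} .{{_ : NonZero k}} {q q′ u u′} →
  u + q * k ≡ u′ + q′ * k → u < k → u′ < k → u ≡ u′
remainder-unique {k} {q} {q′} {u} {u′} eq u<k u′<k = begin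
  u                  ≡⟨ m<n⇒m%n≡m u<k ⟨
  u % k              ≡⟨ [m+kn]%n≡m%n u q k ⟨
  (u + q * k) % k    ≡⟨ cong (_% k) eq ⟩
  (u′ + q′ * k) % k  ≡⟨ [m+kn]%n≡m%n u′ q′ k ⟩
  u′ % k             ≡⟨ m<n⇒m%n≡m u′<k ⟩
  u′                 ∎
  where open ≡-Reasoning

module Blowup {r t : ℕ} (m s : ℕ) (f : ℕ → Fin r) (w : ℕ → Fin t) where

  k : ℕ
  k = suc (3 * s)

  3s<k : s + (s + s) < k
  3s<k = s≤s (≤-reflexive (cong (λ x → s + (s + x)) (sym (+-identityʳ s))))

  2s<k : s + s < k
  2s<k = ≤-<-trans (m≤n+m (s + s) s) 3s<k

  s<k : s < k
  s<k = ≤-<-trans (m≤m+n s s) 2s<k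

  N : ℕ
  N = k * m + (s + s)

  colourQR : ℕ → ℕ → Fin r ⊎ Fin t
  colourQR q ρ with ρ ≤? s | ρ ≤? s + s
  colourQR zero    ρ | yes _ | _     = inj₂ (w ρ)
  colourQR (suc q) ρ | yes _ | _     = inj₁ (f (suc q))
  colourQR q       ρ | no _  | yes _ = inj₂ (w ρ)
  colourQR q       ρ | no _  | no _  = inj₁ (f (suc q))

  colour : ℕ → Fin r ⊎ Fin t
  colour x = colourQR (x / k) (x % k)

  data Placed (x : ℕ) : Fin r ⊎ Fin t → Set where
    nearMultiple : ∀ {i} q → 1 ≤ q → Near s x (q * k) → f q ≡ i → Placed x (inj₁ i)
    offset : ∀ {j} q u → x ≡ u + q * k → u ≤ s + s → (u ≤ s → q ≡ 0) → w u ≡ j →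
             Placed x (inj₂ j)

  placedQR : ∀ q ρ → ρ < k → Placed (ρ + q * k) (colourQR q ρ)
  placedQR q ρ ρ<k with ρ ≤? s | ρ ≤? s + s
  placedQR zero    ρ ρ<k | yes ρ≤s | _ = offset 0 ρ refl (≤-trans ρ≤s (m≤m+n s s)) (λ _ → refl) refl
  placedQR (suc q) ρ ρ<k | yes ρ≤s | _ = nearMultiple (suc q) (s≤s z≤n) (Near-+ˡ _ ρ≤s) refl
  placedQR q ρ ρ<k | no ρ≰s | yes ρ≤2s = offset q ρ refl ρ≤2s (λ ρ≤s → contradiction ρ≤s ρ≰s) refl
  placedQR q ρ ρ<k | no _   | no ρ≰2s  = nearMultiple (suc q) (s≤s z≤n) (Near-+ʳ (q * k) ρ≈k) refl
    where
    k≤ρ+s : k ≤ ρ + s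
    k≤ρ+s = ≤-trans (≤-reflexive (cong suc (lemma s))) (+-monoˡ-≤ s (≰⇒> ρ≰2s))
      where
      lemma : ∀ s → 3 * s ≡ s + s + s
      lemma = solve-∀
    ρ≈k : Near s ρ k
    ρ≈k = ≤-trans (<⇒≤ ρ<k) (m≤m+n k s) , k≤ρ+s

  placed : ∀ x → Placed x (colour x)
  placed x = subst (λ y → Placed y (colour x)) (sym (m≡m%n+[m/n]*n x k))
                   (placedQR (x / k) (x % k) (m%n<n x k))

  colour-multiple : ∀ q → colour (suc q * k) ≡ inj₁ (f (suc q))
  colour-multiple q = cong₂ colourQR (m*n/n≡m (suc q) k) (m*n%n≡0 (suc q) k)

  colour-small : ∀ {u} → u ≤ s + s → colour u ≡ inj₂ (w u)
  colour-small {u} u≤2s =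
    trans (cong₂ colourQR (m<n⇒m/n≡0 u<k) (m<n⇒m%n≡m u<k)) colourQR-zero
    where
    u<k : u < k
    u<k = ≤-<-trans u≤2s 2s<k
    colourQR-zero : colourQR 0 u ≡ inj₂ (w u)
    colourQR-zero with u ≤? s | u ≤? s + s
    ... | yes _ | _        = refl
    ... | no _  | yes _    = refl
    ... | no _  | no u≰2s  = contradiction u≤2s u≰2s

  near-quotients-add : ∀ {a b} qa qb {qc} →
    Near s a (qa * k) → Near s b (qb * k) → Near s (a + b) (qc * k) → qc ≡ qa + qb
  near-quotients-add qa qb {qc} a≈ b≈ c≈ =
    *-cancelʳ-Near qc (qa + qb) 3s<k
      (Near-trans (Near-sym c≈) (subst (Near (s + s) _) (sym (*-distribʳ-+ k qa qb)) (Near-+ a≈ b≈)))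

  quotient-bound : ∀ {c q} → Near s c (q * k) → c ≤ N → q ≤ m
  quotient-bound {q = q} (_ , qk≤) c≤N =
    *-cancelʳ-≤-slack q m 3s<k (≤-trans qk≤ (≤-trans (+-monoˡ-≤ s c≤N) (≤-reflexive (lemma k m s))))
    where
    lemma : ∀ k m s → k * m + (s + s) + s ≡ m * k + (s + (s + s))
    lemma = solve-∀

  offsets-add : ∀ qa qb {ua ub qc uc} → (ua + qa * k) + (ub + qb * k) ≡ uc + qc * k →
    ua ≤ s + s → ub ≤ s + s → uc ≤ s + s → (uc ≤ s → qc ≡ 0) → uc ≡ ua + ub
  offsets-add qa qb {ua} {ub} {qc} {uc} eq ua≤ ub≤ uc≤ small = without-carry (ua + ub <? k)
    where
    uc<k : uc < k
    uc<k = ≤-<-trans uc≤ 2s<k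

    sum : ua + ub + (qa + qb) * k ≡ uc + qc * k
    sum = trans (lemma ua qa ub qb k) eq
      where
      lemma : ∀ ua qa ub qb k → ua + ub + (qa + qb) * k ≡ (ua + qa * k) + (ub + qb * k)
      lemma = solve-∀

    without-carry : Dec (ua + ub < k) → uc ≡ ua + ub
    without-carry (yes ua+ub<k) = sym (remainder-unique {q = qa + qb} {qc} sum ua+ub<k uc<k)
    -- A carry would leave a remainder below s, which only the quotient 0 allows.
    without-carry (no ua+ub≮k) with e , k+e≡ ← m≤n⇒∃[o]m+o≡n (≮⇒≥ ua+ub≮k) =
      contradiction (+-cancelˡ-≡ e _ _ carry′) λ ()
      where
      carry : e + suc (qa + qb) * k ≡ uc + qc * k
      carry = trans (sym (+-assoc e k _)) (trans (cong (_+ (qa + qb) * k) (trans (+-comm e k) k+e≡)) sum)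

      e<s : e < s
      e<s = +-cancelˡ-< (3 * s) e s (begin-strict
        3 * s + e           <⟨ n<1+n (3 * s + e) ⟩
        k + e               ≡⟨ k+e≡ ⟩
        ua + ub             ≤⟨ +-mono-≤ ua≤ ub≤ ⟩
        (s + s) + (s + s)   ≡⟨ lemma s ⟩
        3 * s + s           ∎)
        where
        open ≤-Reasoning
        lemma : ∀ s → (s + s) + (s + s) ≡ 3 * s + s
        lemma = solve-∀

      e≡uc : e ≡ uc
      e≡uc = remainder-unique {q = suc (qa + qb)} {qc} carry (<-trans e<s s<k) uc<k

      carry′ : e + suc (qa + qb) * k ≡ e + 0
      carry′ = trans carry (cong₂ (λ u q → u + q * k) (sym e≡uc) (small (subst (_≤ s) e≡uc (<⇒≤ e<s))))

  offset-positive : ∀ {x q u} → 1 ≤ x → x ≡ u + q * k → (u ≤ s → q ≡ 0) → 1 ≤ u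
  offset-positive {u = suc _} _ _ _ = s≤s z≤n
  offset-positive {u = zero} 1≤x x≡ small =
    contradiction (subst (λ q → 1 ≤ q * k) (small z≤n) (subst (1 ≤_) x≡ 1≤x)) λ ()

  Placed-weaklySumFree : StronglySumFree m f → WeaklySumFree (s + s) w →
    ∀ {a b c} → 1 ≤ a → 1 ≤ b → a ≢ b → a + b ≤ N →
    Placed a c → Placed b c → ¬ Placed (a + b) c
  Placed-weaklySumFree sf _ _ _ _ a+b≤N
    (nearMultiple qa 1≤qa a≈ refl) (nearMultiple qb 1≤qb b≈ fqb) (nearMultiple qc _ c≈ fqc) =
    sf qa qb 1≤qa 1≤qb (subst (_≤ m) qc≡ (quotient-bound c≈ a+b≤N)) (sym fqb)
       (trans (cong f (sym qc≡)) fqc)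
    where
    qc≡ : qc ≡ qa + qb
    qc≡ = near-quotients-add qa qb a≈ b≈ c≈
  Placed-weaklySumFree _ wf 1≤a 1≤b a≢b _
    (offset qa ua a≡ ua≤ sa refl) (offset qb ub b≡ ub≤ sb wub) (offset qc uc c≡ uc≤ sc wuc)
    with uc≡ ← offsets-add qa qb (trans (cong₂ _+_ (sym a≡) (sym b≡)) c≡) ua≤ ub≤ uc≤ sc | ua ≟ ub
  ... | no ua≢ub =
    wf ua ub (offset-positive 1≤a a≡ sa) (offset-positive 1≤b b≡ sb) ua≢ub
       (subst (_≤ s + s) uc≡ uc≤) (sym wub) (trans (cong w (sym uc≡)) wuc)
  ... | yes refl =
    a≢b (trans a≡ (trans (cong (λ q → ua + q * k) (trans (sa ua≤s) (sym (sb ua≤s)))) (sym b≡)))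
    where
    ua≤s : ua ≤ s
    ua≤s with ua ≤? s
    ... | yes ua≤s = ua≤s
    ... | no ua≰s  = contradiction (subst (_≤ s + s) uc≡ uc≤) (<⇒≱ (+-mono-< (≰⇒> ua≰s) (≰⇒> ua≰s)))

  colour-weaklySumFree : StronglySumFree m f → WeaklySumFree (s + s) w → WeaklySumFree N colour
  colour-weaklySumFree sf wf a b 1≤a 1≤b a≢b a+b≤N ca≡cb cab≡ca =
    Placed-weaklySumFree sf wf 1≤a 1≤b a≢b a+b≤N (placed a) (subst (Placed b) (sym ca≡cb) (placed b))
      (subst (Placed (a + b)) cab≡ca (placed (a + b)))

  colour-hits : (∀ i → Hits m f i) → (∀ j → Hits (s + s) w j) → ∀ c → Hits N colour c
  colour-hits hf _ (inj₁ i) with hf i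
  ... | suc q , _ , q≤m , fq≡ =
    suc q * k , s≤s z≤n ,
    ≤-trans (*-monoˡ-≤ k q≤m) (≤-trans (≤-reflexive (*-comm m k)) (m≤m+n (k * m) (s + s))) ,
    trans (colour-multiple q) (cong inj₁ fq≡)
  colour-hits _ hw (inj₂ j) with u , 1≤u , u≤2s , wu≡ ← hw j =
    u , 1≤u , ≤-trans u≤2s (m≤n+m (s + s) (k * m)) , trans (colour-small u≤2s) (cong inj₂ wu≡)

weakSchur-blowup : ∀ {m r t} s → HasStrongSchurPartition m r → HasWeakSchurPartition (s + s) t →
  HasWeakSchurPartition (suc (3 * s) * m + (s + s)) (r + t)
weakSchur-blowup {m} {r} {t} s (f , hf , sf) (w , hw , wf) =
  join r t ∘ colour , isWeakSchurPartition-join (colour-hits hf hw) (colour-weaklySumFree sf wf)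
  where open Blowup m s f w

hasWeakSchur-2-1 : HasWeakSchurPartition 2 1
hasWeakSchur-2-1 = colouring , hits , toWitness {a? = weaklySumFree? 2 colouring} _
  where
  colouring : ℕ → Fin 1
  colouring _ = fzero
  hits : ∀ i → Hits 2 colouring i
  hits fzero = 1 , s≤s z≤n , s≤s z≤n , refl

hasWeakSchur-8-2 : HasWeakSchurPartition 8 2
hasWeakSchur-8-2 = colouring , hits , toWitness {a? = weaklySumFree? 8 colouring} _
  where
  colouring : ℕ → Fin 2
  colouring 1 = fzero
  colouring 2 = fzero
  colouring 4 = fzero
  colouring 8 = fzero
  colouring _ = fsuc fzero
  hits : ∀ i → Hits 8 colouring i
  hits fzero        = 1 , s≤s z≤n , s≤s z≤n , refl
  hits (fsuc fzero) = 3 , s≤s z≤n , s≤s (s≤s (s≤s z≤n)) , refl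

theorem1 : (r m : ℕ) → 1 ≤ r → 1 ≤ m →
    HasStrongSchurPartition m r →
    HasWeakSchurPartition (4 * m + 2) (r + 1) × HasWeakSchurPartition (13 * m + 8) (r + 2)
theorem1 r m _ _ strong = weakSchur-blowup 1 strong hasWeakSchur-2-1 , weakSchur-blowup 4 strong hasWeakSchur-8-2
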